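{- Let $V$ be a finite nonempty set and $f$ a Boolean network on $V$. Suppose that for every integer $1\leq k\leq |V|$ there are at most $2^k-1$ points $x\in\mathbb{B}^V$ such that the local interaction graph $Gf(x)$ has a cycle of length at most $k$. Then $f$ has a unique fixed point.
   Context: $\mathbb{B}=\{0,1\}$. A network on $V$ is a map $f:\mathbb{B}^V\to\mathbb{B}^V$ with components $f_i(x)=f(x)_i$. For $x\in\mathbb{B}^V$, $i\in V$, $\alpha\in\mathbb{B}$, $x^{i\alpha}$ is the point equal to $x$ except that its $i$-component is $\alpha$. The discrete derivative is $f_{ij}(x)=f_i(x^{j1})-f_i(x^{j0})\in\{ -1,0,1\}$. The local interaction graph $Gf(x)$ is the signed digraph on vertex set $V$ having a positive arc from $j$ to $i$ if $f_{ij}(x)=1$ and a negative arc from $j$ to $i$ if $f_{ij}(x)=-1$ (loops allowed). A cycle of a signed digraph is a subgraph with at most one arc from any vertex to any vertex whose underlying unsigned digraph is a directed cycle (a loop is a cycle of length 1); its length is its number of vertices. -}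

module Defs where

open import Data.Bool using (Bool; true; false)
open import Data.Nat using (ℕ; suc; _≤_; _^_; _∸_)
open import Data.Integer using (ℤ; _-_; +_)
open import Data.Fin using (Fin; zero; suc; inject₁; fromℕ)
open import Data.Vec using (Vec; lookup; _[_]≔_)
open import Data.List using (List; length)
open import Data.List.Relation.Unary.All using (All)
open import Data.List.Relation.Unary.Unique.Propositional using (Unique)
open import Data.Product using (Σ; ∃; _×_)
open import Function.Definitions using (Injective)
open import Relation.Binary.PropositionalEquality using (_≡_)
open import Relation.Nullary using (¬_)

-- V is identified with Fin n; 𝔹^V with Vec Bool n.
Point : ℕ → Set
Point n = Vec Bool n

Network : ℕ → Set
Network n = Point n → Point n

comp : ∀ {n} → Network n → Fin n → Point n → Bool
comp f i x = lookup (f x) i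

upd : ∀ {n} → Point n → Fin n → Bool → Point n
upd x i α = x [ i ]≔ α

toℤ : Bool → ℤ
toℤ false = + 0
toℤ true  = + 1

deriv : ∀ {n} → Network n → Fin n → Fin n → Point n → ℤ
deriv f i j x = toℤ (comp f i (upd x j true)) - toℤ (comp f i (upd x j false))

-- Local interaction graph Gf(x): a signed digraph given by the sign of the
-- arc from j to i (0 = no arc, +1 positive arc, -1 negative arc).
SignedDigraph : ℕ → Set
SignedDigraph n = Fin n → Fin n → ℤ   -- sign of arc from j (1st arg) to i (2nd arg)

G : ∀ {n} → Network n → Point n → SignedDigraph n
G f x j i = deriv f i j x

Arc : ∀ {n} → SignedDigraph n → Fin n → Fin n → Set
Arc g j i = ¬ (g j i ≡ + 0)

-- a cycle of length (suc m): pairwise distinct vertices v 0, …, v m with arcs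
-- v t → v (t+1) and v m → v 0 (a loop when m = 0).
IsCycle : ∀ {n m} → SignedDigraph n → (Fin (suc m) → Fin n) → Set
IsCycle {n} {m} g v =
  Injective _≡_ _≡_ v ×
  ((t : Fin m) → Arc g (v (inject₁ t)) (v (suc t))) ×
  Arc g (v (fromℕ m)) (v zero)

HasCycleOfLengthAtMost : ∀ {n} → SignedDigraph n → ℕ → Set
HasCycleOfLengthAtMost {n} g k =
  Σ ℕ λ m → suc m ≤ k × Σ (Fin (suc m) → Fin n) λ v → IsCycle g v

-- "at most b points satisfy P": every duplicate-free list of points satisfying P
-- has length ≤ b.
AtMost : ∀ {n} → ℕ → (Point n → Set) → Set
AtMost {n} b P = (xs : List (Point n)) → Unique xs → All P xs → length xs ≤ b

UniqueFixedPoint : ∀ {n} → Network n → Set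
UniqueFixedPoint {n} f = Σ (Point n) λ x → f x ≡ x × ((y : Point n) → f y ≡ y → y ≡ x)

-- If no Gf(x) has a vertex without outgoing arcs, each of
-- the 2^|V| graphs Gf(x) has a cycle, contradicting the bound for k = |V|.
-- Otherwise some j has no outgoing arc in Gf(x), so f(x) = f(x^{j,¬x_j}), and
-- for A = f(x) ⊕ x the twisted network f ⊕ A maps both x and its j-neighbour
-- to x.  Freezing one coordinate of any twist f ⊕ A preserves the hypothesis,
-- so these restrictions have unique fixed points by induction.  For a network
-- h whose restrictions at j have unique fixed points, h has a unique fixed
-- point iff h_j is constant on the points fixed by h away from j.  This holds
-- for the twist above and survives negating h_j, i.e. changing one entry of A;
-- so it carries over to A = 0, that is, to f.
module Submission where

open import Defs
open import Data.Bool using (Bool; true; false; not; _xor_)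
import Data.Bool.Properties as BoolP
open import Data.Empty using (⊥-elim)
open import Data.Fin as Fin using (Fin; zero; suc; inject₁; fromℕ; toℕ; punchIn)
import Data.Fin.Properties as FinP
open import Data.Integer using (+_; _-_)
import Data.Integer as ℤ
import Data.Integer.Properties as ℤP
open import Data.List using (List; []; _∷_; map; length; _++_)
import Data.List.Properties as ListP
open import Data.List.Membership.Propositional using (_∈_; lose)
open import Data.List.Membership.Propositional.Properties using (∈-map⁺; ∈-map⁻; ∈-++⁺ˡ; ∈-++⁺ʳ)
open import Data.List.Relation.Unary.All as All using (All)
import Data.List.Relation.Unary.All.Properties as AllP
import Data.List.Relation.Unary.AllPairs as AllPairs
open import Data.List.Relation.Unary.Any using (here; any?; satisfied)
open import Data.List.Relation.Unary.Unique.Propositional using (Unique)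
import Data.List.Relation.Unary.Unique.Propositional.Properties as UniqueP
open import Data.Nat using (ℕ; zero; suc; _+_; _∸_; _^_; _≤_; _<_; z≤n; s≤s; z<s)
import Data.Nat.Properties as ℕP
open import Data.Nat.Induction using (<-rec)
open import Data.Product using (Σ; ∃; ∃₂; _×_; _,_; proj₁; proj₂)
open import Data.Sum using (_⊎_; inj₁; inj₂)
open import Data.Vec using (Vec; []; _∷_; lookup; _[_]≔_; insertAt; removeAt; zipWith; replicate)
import Data.Vec.Properties as VecP
open import Function using (_∘_)
open import Function.Definitions using (Injective)
open import Relation.Binary.Definitions using (tri<; tri≈; tri>)
open import Relation.Binary.PropositionalEquality
open import Relation.Nullary using (¬_; yes; no)
open import Relation.Nullary.Decidable using (_×-dec_)
open import Relation.Unary using (Decidable)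

private
  variable
    n : ℕ
    A : Set

≗-lookup⇒≡ : {xs ys : Vec A n} → (∀ i → lookup xs i ≡ lookup ys i) → xs ≡ ys
≗-lookup⇒≡ {xs = xs} {ys} eq =
  trans (sym (VecP.tabulate∘lookup xs)) (trans (VecP.tabulate-cong eq) (VecP.tabulate∘lookup ys))

Vec-0-unique : (xs ys : Vec A 0) → xs ≡ ys
Vec-0-unique [] [] = refl

lookup-removeAt : (xs : Vec A (suc n)) (i : Fin (suc n)) (j : Fin n) →
                  lookup (removeAt xs i) j ≡ lookup xs (punchIn i j)
lookup-removeAt (x ∷ xs)     zero    j       = refl
lookup-removeAt (x ∷ y ∷ xs) (suc i) zero    = refl
lookup-removeAt (x ∷ y ∷ xs) (suc i) (suc j) = lookup-removeAt (y ∷ xs) i j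

removeAt-cong : (xs ys : Vec A (suc n)) (i : Fin (suc n)) →
                (∀ j → j ≢ i → lookup xs j ≡ lookup ys j) → removeAt xs i ≡ removeAt ys i
removeAt-cong xs ys i eq = ≗-lookup⇒≡ λ j → begin
  lookup (removeAt xs i) j  ≡⟨ lookup-removeAt xs i j ⟩
  lookup xs (punchIn i j)   ≡⟨ eq (punchIn i j) (FinP.punchInᵢ≢i i j) ⟩
  lookup ys (punchIn i j)   ≡⟨ lookup-removeAt ys i j ⟨
  lookup (removeAt ys i) j  ∎
  where open ≡-Reasoning

removeAt-[]≔ : (xs : Vec A (suc n)) (i : Fin (suc n)) (a : A) → removeAt (xs [ i ]≔ a) i ≡ removeAt xs i
removeAt-[]≔ xs i a = removeAt-cong (xs [ i ]≔ a) xs i λ j j≢i → VecP.lookup∘update′ j≢i xs a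

removeAt-lookup-injective : (xs ys : Vec A (suc n)) (i : Fin (suc n)) →
                            removeAt xs i ≡ removeAt ys i → lookup xs i ≡ lookup ys i → xs ≡ ys
removeAt-lookup-injective xs ys i r l = begin
  xs                                        ≡⟨ VecP.insertAt-removeAt xs i ⟨
  insertAt (removeAt xs i) i (lookup xs i)  ≡⟨ cong₂ (λ zs z → insertAt zs i z) r l ⟩
  insertAt (removeAt ys i) i (lookup ys i)  ≡⟨ VecP.insertAt-removeAt ys i ⟩
  ys                                        ∎
  where open ≡-Reasoning

insertAt-injective : (i : Fin (suc n)) (a : A) {xs ys : Vec A n} → insertAt xs i a ≡ insertAt ys i a → xs ≡ ys
insertAt-injective i a {xs} {ys} eq =
  trans (sym (VecP.removeAt-insertAt xs i a))
        (trans (cong (λ zs → removeAt zs i) eq) (VecP.removeAt-insertAt ys i a))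

insertAt-[]≔ : (xs : Vec A n) (i : Fin (suc n)) (a : A) (j : Fin n) (b : A) →
               insertAt (xs [ j ]≔ b) i a ≡ insertAt xs i a [ punchIn i j ]≔ b
insertAt-[]≔ xs       zero    a j       b = refl
insertAt-[]≔ (x ∷ xs) (suc i) a zero    b = refl
insertAt-[]≔ (x ∷ xs) (suc i) a (suc j) b = cong (x ∷_) (insertAt-[]≔ xs i a j b)

[]≔-closed⇒universal : (P : Vec A n → Set) → (∀ xs i a → P xs → P (xs [ i ]≔ a)) →
                       ∀ xs ys → P xs → P ys
[]≔-closed⇒universal P closed []       []       p = p
[]≔-closed⇒universal P closed (x ∷ xs) (y ∷ ys) p =
  []≔-closed⇒universal (λ zs → P (y ∷ zs)) (λ zs i a → closed (y ∷ zs) (suc i) a) xs ys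
                       (closed (x ∷ xs) zero y p)

points : ∀ n → List (Point n)
points zero    = [] ∷ []
points (suc n) = map (true ∷_) (points n) ++ map (false ∷_) (points n)

∈-points : (x : Point n) → x ∈ points n
∈-points []          = here refl
∈-points (true ∷ x)  = ∈-++⁺ˡ (∈-map⁺ (true ∷_) (∈-points x))
∈-points {suc n} (false ∷ x) = ∈-++⁺ʳ (map (true ∷_) (points n)) (∈-map⁺ (false ∷_) (∈-points x))

points-unique : ∀ n → Unique (points n)
points-unique zero    = All.[] AllPairs.∷ AllPairs.[]
points-unique (suc n) =
  UniqueP.++⁺ (UniqueP.map⁺ ∷-injectiveʳ (points-unique n))
              (UniqueP.map⁺ ∷-injectiveʳ (points-unique n)) disjoint
  where
  ∷-injectiveʳ : ∀ {b} {x y : Point n} → b ∷ x ≡ b ∷ y → x ≡ y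
  ∷-injectiveʳ refl = refl
  disjoint : ∀ {x} → ¬ (x ∈ map (true ∷_) (points n) × x ∈ map (false ∷_) (points n))
  disjoint (p , q) with ∈-map⁻ (true ∷_) p | ∈-map⁻ (false ∷_) q
  ... | _ , _ , refl | _ , _ , ()

length-points : ∀ n → length (points n) ≡ 2 ^ n
length-points zero    = refl
length-points (suc n) = begin
  length (map (true ∷_) (points n) ++ map (false ∷_) (points n))
    ≡⟨ ListP.length-++ (map (true ∷_) (points n)) ⟩
  length (map (true ∷_) (points n)) + length (map (false ∷_) (points n))
    ≡⟨ cong₂ _+_ (ListP.length-map _ (points n)) (ListP.length-map _ (points n)) ⟩
  length (points n) + length (points n)
    ≡⟨ cong (λ m → m + m) (length-points n) ⟩
  2 ^ n + 2 ^ n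
    ≡⟨ cong (λ m → 2 ^ n + m) (ℕP.+-identityʳ (2 ^ n)) ⟨
  2 ^ suc n ∎
  where open ≡-Reasoning

AtMost-map : ∀ {m b} {P : Point n → Set} {Q : Point m → Set} (φ : Point n → Point m) →
             (∀ {x y} → φ x ≡ φ y → x ≡ y) → (∀ {x} → P x → Q (φ x)) → AtMost b Q → AtMost b P
AtMost-map {b = b} φ φ-injective P⇒Q bound xs unique all =
  subst (_≤ b) (ListP.length-map φ xs)
    (bound (map φ xs) (UniqueP.map⁺ φ-injective unique) (AllP.map⁺ (All.map P⇒Q all)))

HasCycle : SignedDigraph n → Set
HasCycle {n} g = Σ ℕ λ m → Σ (Fin (suc m) → Fin n) (IsCycle g)

hasCycle⇒hasCycleOfLengthAtMost : {g : SignedDigraph n} → HasCycle g → HasCycleOfLengthAtMost g n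
hasCycle⇒hasCycleOfLengthAtMost (m , v , cycle@(v-injective , _)) = m , FinP.injective⇒≤ v-injective , v , cycle

HasCycleOfLengthAtMost-map : ∀ {m k} {g : SignedDigraph n} {g′ : SignedDigraph m} (φ : Fin n → Fin m) →
  (∀ {i j} → φ i ≡ φ j → i ≡ j) → (∀ {j i} → Arc g j i → Arc g′ (φ j) (φ i)) →
  HasCycleOfLengthAtMost g k → HasCycleOfLengthAtMost g′ k
HasCycleOfLengthAtMost-map φ φ-injective arc (m , m<k , v , (v-injective , arcs , closing)) =
  m , m<k , (λ t → φ (v t)) , (λ eq → v-injective (φ-injective eq)) , (λ t → arc (arcs t)) , arc closing

injective-or-collision : ∀ {k m} (v : Fin k → Fin m) →
                         Injective _≡_ _≡_ v ⊎ ∃₂ λ a b → a Fin.< b × v a ≡ v b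
injective-or-collision v with FinP.any? (λ a → FinP.any? (λ b → (a FinP.<? b) ×-dec (v a Fin.≟ v b)))
... | yes (a , b , a<b , eq) = inj₂ (a , b , a<b , eq)
... | no no-collision        = inj₁ v-injective
  where
  v-injective : Injective _≡_ _≡_ v
  v-injective {a} {b} eq with FinP.<-cmp a b
  ... | tri< a<b _ _ = ⊥-elim (no-collision (a , b , a<b , eq))
  ... | tri≈ _ a≡b _ = a≡b
  ... | tri> _ _ b<a = ⊥-elim (no-collision (b , a , b<a , sym eq))

module _ (g : SignedDigraph n) (next : Fin n → Fin n) (arc : ∀ j → Arc g j (next j)) where

  orbit : Fin n → ℕ → Fin n
  orbit z zero    = z
  orbit z (suc t) = next (orbit z t)

  orbit-+ : ∀ z a b → orbit (orbit z a) b ≡ orbit z (b + a)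
  orbit-+ z a zero    = refl
  orbit-+ z a (suc b) = cong next (orbit-+ z a b)

  collision⇒periodic : ∀ z {a b} → a < b → orbit z a ≡ orbit z b →
                       orbit (orbit z a) (suc (b ∸ suc a)) ≡ orbit z a
  collision⇒periodic z {a} {b} a<b eq = begin
    orbit (orbit z a) (suc (b ∸ suc a))  ≡⟨ orbit-+ z a (suc (b ∸ suc a)) ⟩
    orbit z (suc (b ∸ suc a) + a)        ≡⟨ cong (orbit z) (ℕP.+-suc (b ∸ suc a) a) ⟨
    orbit z (b ∸ suc a + suc a)          ≡⟨ cong (orbit z) (ℕP.m∸n+n≡m a<b) ⟩
    orbit z b                            ≡⟨ eq ⟨
    orbit z a                            ∎
    where open ≡-Reasoning

  -- Either the first q+1 points of the orbit are distinct, giving the cycle, or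
  -- they collide, giving a shorter period.
  periodic⇒hasCycle : ∀ q z → orbit z (suc q) ≡ z → HasCycle g
  periodic⇒hasCycle = <-rec _ step
    where
    step : ∀ q → (∀ {p} → p < q → ∀ z → orbit z (suc p) ≡ z → HasCycle g) →
           ∀ z → orbit z (suc q) ≡ z → HasCycle g
    step q shorter z periodic with injective-or-collision (λ (t : Fin (suc q)) → orbit z (toℕ t))
    ... | inj₁ v-injective = q , (λ t → orbit z (toℕ t)) , v-injective , arcs , closing
      where
      arcs : (t : Fin q) → Arc g (orbit z (toℕ (inject₁ t))) (orbit z (suc (toℕ t)))
      arcs t = subst (λ s → Arc g (orbit z s) (orbit z (suc (toℕ t)))) (sym (FinP.toℕ-inject₁ t)) (arc _)
      closing : Arc g (orbit z (toℕ (fromℕ q))) z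
      closing = subst₂ (λ s y → Arc g (orbit z s) y) (sym (FinP.toℕ-fromℕ q)) periodic (arc _)
    ... | inj₂ (a , b , a<b , eq) =
      shorter (ℕP.<-≤-trans (ℕP.∸-monoʳ-< z<s a<b) (FinP.toℕ≤pred[n] b))
              (orbit z (toℕ a)) (collision⇒periodic z a<b eq)

  successor⇒hasCycle : Fin n → HasCycle g
  successor⇒hasCycle z with FinP.pigeonhole (ℕP.n<1+n n) (λ t → orbit z (toℕ t))
  ... | a , b , a<b , eq = periodic⇒hasCycle (toℕ b ∸ suc (toℕ a)) _ (collision⇒periodic z a<b eq)

Sink : SignedDigraph n → Fin n → Set
Sink g j = ∀ i → g j i ≡ + 0

sink? : (g : SignedDigraph n) → Decidable (Sink g)
sink? g j = FinP.all? (λ i → g j i ℤ.≟ + 0)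

sink-or-hasCycle : (g : SignedDigraph (suc n)) → ∃ (Sink g) ⊎ HasCycle g
sink-or-hasCycle g with FinP.any? (sink? g)
... | yes sink   = inj₁ sink
... | no no-sink = inj₂ (successor⇒hasCycle g (λ j → proj₁ (out-arc j)) (λ j → proj₂ (out-arc j)) zero)
  where
  out-arc : ∀ j → ∃ (Arc g j)
  out-arc j = FinP.¬∀⟶∃¬ _ _ (λ i → g j i ℤ.≟ + 0) (λ sink → no-sink (j , sink))

-- Twists and restrictions of networks

CyclesBounded : Network n → Set
CyclesBounded {n} f =
  (k : ℕ) → 1 ≤ k → k ≤ n → AtMost (2 ^ k ∸ 1) (λ x → HasCycleOfLengthAtMost (G f x) k)

toℤ-injective : ∀ {a b} → toℤ a ≡ toℤ b → a ≡ b
toℤ-injective {false} {false} _ = refl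
toℤ-injective {true}  {true}  _ = refl

sink⇒[]≔-invariant : {f : Network n} {x : Point n} {j : Fin n} →
                     Sink (G f x) j → ∀ a → f (x [ j ]≔ a) ≡ f x
sink⇒[]≔-invariant {f = f} {x} {j} sink a = trans (invariant a (lookup x j)) (cong f (VecP.[]≔-lookup x j))
  where
  true≡false : f (x [ j ]≔ true) ≡ f (x [ j ]≔ false)
  true≡false = ≗-lookup⇒≡ λ i → toℤ-injective (ℤP.i-j≡0⇒i≡j _ _ (sink i))
  invariant : ∀ a b → f (x [ j ]≔ a) ≡ f (x [ j ]≔ b)
  invariant false false = refl
  invariant true  true  = refl
  invariant true  false = true≡false
  invariant false true  = sym true≡false

_⊕_ : Network n → Point n → Network n
(f ⊕ A) x = zipWith _xor_ (f x) A

-- Twisting only negates components of f, so it can only change the signs of arcs.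
Arc-⊕ : (f : Network n) (A x : Point n) {j i : Fin n} → Arc (G (f ⊕ A) x) j i → Arc (G f x) j i
Arc-⊕ f A x {j} {i} arc no-arc = arc (begin
  toℤ (lookup ((f ⊕ A) x₁) i) - toℤ (lookup ((f ⊕ A) x₀) i)
    ≡⟨ cong₂ (λ u v → toℤ u - toℤ v) (VecP.lookup-zipWith _xor_ i (f x₁) A)
                                       (VecP.lookup-zipWith _xor_ i (f x₀) A) ⟩
  toℤ (comp f i x₁ xor lookup A i) - toℤ (comp f i x₀ xor lookup A i)
    ≡⟨ cong (λ u → toℤ (u xor lookup A i) - toℤ (comp f i x₀ xor lookup A i)) f₁≡f₀ ⟩
  toℤ (comp f i x₀ xor lookup A i) - toℤ (comp f i x₀ xor lookup A i)
    ≡⟨ ℤP.i≡j⇒i-j≡0 {toℤ (comp f i x₀ xor lookup A i)} refl ⟩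
  + 0 ∎)
  where
  open ≡-Reasoning
  x₁ = x [ j ]≔ true
  x₀ = x [ j ]≔ false
  f₁≡f₀ : comp f i x₁ ≡ comp f i x₀
  f₁≡f₀ = toℤ-injective (ℤP.i-j≡0⇒i≡j _ _ no-arc)

⊕-fixes : (f : Network n) (x : Point n) → (f ⊕ zipWith _xor_ (f x) x) x ≡ x
⊕-fixes f x = ≗-lookup⇒≡ λ i → begin
  lookup ((f ⊕ zipWith _xor_ (f x) x) x) i
    ≡⟨ VecP.lookup-zipWith _xor_ i (f x) _ ⟩
  comp f i x xor lookup (zipWith _xor_ (f x) x) i
    ≡⟨ cong (comp f i x xor_) (VecP.lookup-zipWith _xor_ i (f x) x) ⟩
  comp f i x xor (comp f i x xor lookup x i)
    ≡⟨ BoolP.xor-assoc (comp f i x) _ _ ⟨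
  (comp f i x xor comp f i x) xor lookup x i
    ≡⟨ cong (_xor lookup x i) (BoolP.xor-same (comp f i x)) ⟩
  lookup x i ∎
  where open ≡-Reasoning

⊕-identityʳ : (f : Network n) (x : Point n) → (f ⊕ replicate n false) x ≡ f x
⊕-identityʳ {n} f x = ≗-lookup⇒≡ λ i →
  trans (VecP.lookup-zipWith _xor_ i (f x) _)
        (trans (cong (comp f i x xor_) (VecP.lookup-replicate i false)) (BoolP.xor-identityʳ _))

CyclesBounded-⊕ : (f : Network n) → CyclesBounded f → ∀ A → CyclesBounded (f ⊕ A)
CyclesBounded-⊕ f bounded A k 1≤k k≤n =
  AtMost-map (λ x → x) (λ eq → eq)
    (λ {x} → HasCycleOfLengthAtMost-map {g = G (f ⊕ A) x} (λ i → i) (λ eq → eq) (Arc-⊕ f A x))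
    (bounded k 1≤k k≤n)

restrict : Network (suc n) → Fin (suc n) → Bool → Network n
restrict h j b y = removeAt (h (insertAt y j b)) j

deriv-restrict : (h : Network (suc n)) (j : Fin (suc n)) (b : Bool) (i k : Fin n) (y : Point n) →
                 deriv (restrict h j b) i k y ≡ deriv h (punchIn j i) (punchIn j k) (insertAt y j b)
deriv-restrict h j b i k y = cong₂ (λ u w → toℤ u - toℤ w) (comp-restrict true) (comp-restrict false)
  where
  comp-restrict : ∀ a → comp (restrict h j b) i (y [ k ]≔ a) ≡
                        comp h (punchIn j i) (insertAt y j b [ punchIn j k ]≔ a)
  comp-restrict a = trans (lookup-removeAt (h (insertAt (y [ k ]≔ a) j b)) j i)
    (cong (λ z → lookup (h z) (punchIn j i)) (insertAt-[]≔ y j b k a))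

CyclesBounded-restrict : (h : Network (suc n)) → CyclesBounded h → ∀ j b → CyclesBounded (restrict h j b)
CyclesBounded-restrict h bounded j b k 1≤k k≤n =
  AtMost-map (λ y → insertAt y j b) (insertAt-injective j b)
    (λ {y} → HasCycleOfLengthAtMost-map {g = G (restrict h j b) y} {g′ = G h (insertAt y j b)}
               (punchIn j) (FinP.punchIn-injective j _ _)
               (λ {k} {i} arc no-arc → arc (trans (deriv-restrict h j b i k y) no-arc)))
    (bounded k 1≤k (ℕP.m≤n⇒m≤1+n k≤n))

-- Fixed points away from one coordinate

FixedOff : Network (suc n) → Fin (suc n) → Point (suc n) → Set
FixedOff h j y = removeAt (h y) j ≡ removeAt y j

ConstantOnFixedOff : Network (suc n) → Fin (suc n) → Set
ConstantOnFixedOff h j = ∀ {y z} → FixedOff h j y → FixedOff h j z → lookup (h y) j ≡ lookup (h z) j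

fixed⇒fixedOff : (h : Network (suc n)) (j : Fin (suc n)) {y : Point (suc n)} → h y ≡ y → FixedOff h j y
fixed⇒fixedOff h j hy≡y = cong (λ z → removeAt z j) hy≡y

fixedOff⇒fixed : (h : Network (suc n)) (j : Fin (suc n)) {y : Point (suc n)} →
                 FixedOff h j y → lookup (h y) j ≡ lookup y j → h y ≡ y
fixedOff⇒fixed h j {y} = removeAt-lookup-injective (h y) y j

ufp-cong : {f g : Network n} → (∀ x → f x ≡ g x) → UniqueFixedPoint f → UniqueFixedPoint g
ufp-cong f≗g (x , fx≡x , unique) =
  x , trans (sym (f≗g x)) fx≡x , λ y gy≡y → unique y (trans (f≗g y) gy≡y)

-- The points fixed by h away from j are the fixed points of the two
-- restrictions at j, reinserted; when those are unique there is exactly one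
-- such point with each value of the j-th coordinate.
module _ {n} (h : Network (suc n)) (j : Fin (suc n))
         (restrict-ufp : ∀ b → UniqueFixedPoint (restrict h j b)) where

  fixedOff-injective : ∀ {y z} → FixedOff h j y → FixedOff h j z → lookup y j ≡ lookup z j → y ≡ z
  fixedOff-injective {y} {z} fy fz y≡z-at-j =
    removeAt-lookup-injective y z j (trans (onto-w fy refl) (sym (onto-w fz (sym y≡z-at-j)))) y≡z-at-j
    where
    w = proj₁ (restrict-ufp (lookup y j))
    onto-w : ∀ {x} → FixedOff h j x → lookup x j ≡ lookup y j → removeAt x j ≡ w
    onto-w {x} fx x≡y-at-j = proj₂ (proj₂ (restrict-ufp (lookup y j))) (removeAt x j) (begin
      restrict h j (lookup y j) (removeAt x j)
        ≡⟨ cong (λ b → restrict h j b (removeAt x j)) x≡y-at-j ⟨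
      removeAt (h (insertAt (removeAt x j) j (lookup x j))) j
        ≡⟨ cong (λ v → removeAt (h v) j) (VecP.insertAt-removeAt x j) ⟩
      removeAt (h x) j
        ≡⟨ fx ⟩
      removeAt x j ∎)
      where open ≡-Reasoning

  fixedOffAt : Bool → Point (suc n)
  fixedOffAt b = insertAt (proj₁ (restrict-ufp b)) j b

  fixedOff-fixedOffAt : ∀ b → FixedOff h j (fixedOffAt b)
  fixedOff-fixedOffAt b = trans (proj₁ (proj₂ (restrict-ufp b))) (sym (VecP.removeAt-insertAt _ j b))

  lookup-fixedOffAt : ∀ b → lookup (fixedOffAt b) j ≡ b
  lookup-fixedOffAt b = VecP.insertAt-lookup _ j b

  constant⇒ufp : ConstantOnFixedOff h j → UniqueFixedPoint h
  constant⇒ufp constant = p , hp≡p , unique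
    where
    c = lookup (h (fixedOffAt false)) j
    p = fixedOffAt c
    h-at-j≡c : ∀ {y} → FixedOff h j y → lookup (h y) j ≡ c
    h-at-j≡c fy = constant fy (fixedOff-fixedOffAt false)
    hp≡p : h p ≡ p
    hp≡p = fixedOff⇒fixed h j (fixedOff-fixedOffAt c)
             (trans (h-at-j≡c (fixedOff-fixedOffAt c)) (sym (lookup-fixedOffAt c)))
    unique : ∀ y → h y ≡ y → y ≡ p
    unique y hy≡y = fixedOff-injective fy (fixedOff-fixedOffAt c)
      (trans (cong (λ v → lookup v j) (sym hy≡y)) (trans (h-at-j≡c fy) (sym (lookup-fixedOffAt c))))
      where fy = fixed⇒fixedOff h j hy≡y

  -- A point fixed away from j but not on the side of the fixed point z cannot
  -- be fixed, so h moves its j-th coordinate onto that of z.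
  ufp⇒constant : UniqueFixedPoint h → ConstantOnFixedOff h j
  ufp⇒constant (z , hz≡z , unique) fy fz = trans (towards-z fy) (sym (towards-z fz))
    where
    towards-z : ∀ {y} → FixedOff h j y → lookup (h y) j ≡ lookup z j
    towards-z {y} fy with lookup y j BoolP.≟ lookup z j
    ... | yes y≡z-at-j = cong (λ v → lookup v j) (trans (cong h y≡z) hz≡z)
      where y≡z = fixedOff-injective fy (fixed⇒fixedOff h j hz≡z) y≡z-at-j
    ... | no y≢z-at-j with lookup (h y) j BoolP.≟ lookup y j
    ...   | yes fixed-at-j =
      ⊥-elim (y≢z-at-j (cong (λ v → lookup v j) (unique y (fixedOff⇒fixed h j fy fixed-at-j))))
    ...   | no moved-at-j  = trans (BoolP.¬-not moved-at-j) (sym (BoolP.¬-not (y≢z-at-j ∘ sym)))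

  twin-fixed⇒ufp : ∀ {x} → h x ≡ x → h (x [ j ]≔ not (lookup x j)) ≡ x → UniqueFixedPoint h
  twin-fixed⇒ufp {x} hx≡x hx′≡x =
    constant⇒ufp λ fy fz → cong (λ v → lookup v j) (trans (onto-x fy) (sym (onto-x fz)))
    where
    x′ = x [ j ]≔ not (lookup x j)
    fx′ : FixedOff h j x′
    fx′ = trans (cong (λ v → removeAt v j) hx′≡x) (sym (removeAt-[]≔ x j _))
    onto-x : ∀ {y} → FixedOff h j y → h y ≡ x
    onto-x {y} fy with lookup y j BoolP.≟ lookup x j
    ... | yes y≡x-at-j = trans (cong h (fixedOff-injective fy (fixed⇒fixedOff h j hx≡x) y≡x-at-j)) hx≡x
    ... | no y≢x-at-j  = trans (cong h (fixedOff-injective fy fx′ y≡x′-at-j)) hx′≡x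
      where y≡x′-at-j = trans (BoolP.¬-not y≢x-at-j) (sym (VecP.lookup∘update j x _))

negate-component-ufp : {h h′ : Network (suc n)} (j : Fin (suc n)) →
  (∀ y → removeAt (h′ y) j ≡ removeAt (h y) j) → (∀ y → lookup (h′ y) j ≡ not (lookup (h y) j)) →
  (∀ b → UniqueFixedPoint (restrict h j b)) → (∀ b → UniqueFixedPoint (restrict h′ j b)) →
  UniqueFixedPoint h → UniqueFixedPoint h′
negate-component-ufp {h = h} {h′} j same-off negated restrict-ufp restrict-ufp′ ufp =
  constant⇒ufp h′ j restrict-ufp′ λ {y} {z} fy fz → begin
    lookup (h′ y) j        ≡⟨ negated y ⟩
    not (lookup (h y) j)   ≡⟨ cong not (ufp⇒constant h j restrict-ufp ufp (fixedOff fy) (fixedOff fz)) ⟩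
    not (lookup (h z) j)   ≡⟨ negated z ⟨
    lookup (h′ z) j        ∎
  where
  open ≡-Reasoning
  fixedOff : ∀ {y} → FixedOff h′ j y → FixedOff h j y
  fixedOff {y} fy = trans (sym (same-off y)) fy

ufp-⊕-transfer : (f : Network (suc n)) → (∀ A j b → UniqueFixedPoint (restrict (f ⊕ A) j b)) →
                 ∀ A B → UniqueFixedPoint (f ⊕ A) → UniqueFixedPoint (f ⊕ B)
ufp-⊕-transfer f restrict-ufp = []≔-closed⇒universal (λ A → UniqueFixedPoint (f ⊕ A)) step
  where
  step : ∀ A j c → UniqueFixedPoint (f ⊕ A) → UniqueFixedPoint (f ⊕ (A [ j ]≔ c))
  step A j c ufp with c BoolP.≟ lookup A j
  ... | yes refl = subst (λ B → UniqueFixedPoint (f ⊕ B)) (sym (VecP.[]≔-lookup A j)) ufp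
  ... | no c≢Aj  = negate-component-ufp j same-off negated (restrict-ufp A j) (restrict-ufp _ j) ufp
    where
    lookup-⊕ : ∀ B y i → lookup ((f ⊕ B) y) i ≡ lookup (f y) i xor lookup B i
    lookup-⊕ B y i = VecP.lookup-zipWith _xor_ i (f y) B
    same-off : ∀ y → removeAt ((f ⊕ (A [ j ]≔ c)) y) j ≡ removeAt ((f ⊕ A) y) j
    same-off y = removeAt-cong ((f ⊕ (A [ j ]≔ c)) y) ((f ⊕ A) y) j λ i i≢j →
      trans (lookup-⊕ _ y i)
            (trans (cong (lookup (f y) i xor_) (VecP.lookup∘update′ i≢j A c)) (sym (lookup-⊕ A y i)))
    negated : ∀ y → lookup ((f ⊕ (A [ j ]≔ c)) y) j ≡ not (lookup ((f ⊕ A) y) j)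
    negated y = begin
      lookup ((f ⊕ (A [ j ]≔ c)) y) j
        ≡⟨ lookup-⊕ _ y j ⟩
      lookup (f y) j xor lookup (A [ j ]≔ c) j
        ≡⟨ cong (lookup (f y) j xor_) (trans (VecP.lookup∘update j A c) (BoolP.¬-not c≢Aj)) ⟩
      lookup (f y) j xor not (lookup A j)
        ≡⟨ BoolP.not-distribʳ-xor (lookup (f y) j) (lookup A j) ⟨
      not (lookup (f y) j xor lookup A j)
        ≡⟨ cong not (lookup-⊕ A y j) ⟨
      not (lookup ((f ⊕ A) y) j) ∎
      where open ≡-Reasoning

sink-somewhere-or-cyclic-everywhere : (f : Network (suc n)) →
  (∃₂ λ x j → Sink (G f x) j) ⊎ (∀ x → HasCycle (G f x))
sink-somewhere-or-cyclic-everywhere {n} f with any? (λ x → FinP.any? (sink? (G f x))) (points (suc n))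
... | yes somewhere = inj₁ (satisfied somewhere)
... | no nowhere    = inj₂ cyclic
  where
  cyclic : ∀ x → HasCycle (G f x)
  cyclic x with sink-or-hasCycle (G f x)
  ... | inj₁ sink  = ⊥-elim (nowhere (lose (∈-points x) sink))
  ... | inj₂ cycle = cycle

cyclic-everywhere-violates-bound : (f : Network (suc n)) → CyclesBounded f → ¬ (∀ x → HasCycle (G f x))
cyclic-everywhere-violates-bound {n} f bounded cyclic = ℕP.<⇒≱ (ℕP.∸-monoʳ-< z<s (ℕP.m^n>0 2 (suc n)))
  (subst (_≤ 2 ^ suc n ∸ 1) (length-points (suc n))
    (bounded (suc n) (s≤s z≤n) ℕP.≤-refl (points (suc n)) (points-unique (suc n))
      (All.tabulate λ {x} _ → hasCycle⇒hasCycleOfLengthAtMost {g = G f x} (cyclic x))))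

unique-fixed-point : ∀ n (f : Network n) → CyclesBounded f → UniqueFixedPoint f
unique-fixed-point zero    f _ = [] , Vec-0-unique _ _ , λ y _ → Vec-0-unique _ _
unique-fixed-point (suc n) f bounded with sink-somewhere-or-cyclic-everywhere f
... | inj₂ cyclic        = ⊥-elim (cyclic-everywhere-violates-bound f bounded cyclic)
... | inj₁ (x , j , sink) =
  ufp-cong (⊕-identityʳ f) (ufp-⊕-transfer f restrict-ufp A₀ (replicate (suc n) false) ufp-A₀)
  where
  restrict-ufp : ∀ A j b → UniqueFixedPoint (restrict (f ⊕ A) j b)
  restrict-ufp A j b = unique-fixed-point n (restrict (f ⊕ A) j b)
                         (CyclesBounded-restrict (f ⊕ A) (CyclesBounded-⊕ f bounded A) j b)
  A₀ = zipWith _xor_ (f x) x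
  ufp-A₀ : UniqueFixedPoint (f ⊕ A₀)
  ufp-A₀ = twin-fixed⇒ufp (f ⊕ A₀) j (restrict-ufp A₀ j) (⊕-fixes f x)
    (trans (cong (λ y → zipWith _xor_ y A₀) (sink⇒[]≔-invariant {f = f} sink _)) (⊕-fixes f x))

corollary3 : (n : ℕ) → 1 ≤ n → (f : Network n) →
    ((k : ℕ) → 1 ≤ k → k ≤ n →
    AtMost (2 ^ k ∸ 1) (λ x → HasCycleOfLengthAtMost (G f x) k)) →
    UniqueFixedPoint f
corollary3 n _ f bounded = unique-fixed-point n f bounded
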